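{- Let $N_2$ be the set of non-negative integers whose base-$3$ representation uses only the digits $0$ and $1$. For each integer $n\ge0$ let $\ell_n=\ell_n^++\ell_n^-$, where $\ell_n^+,\ell_n^-$ are the unique non-negative integers with $\ell_n^+,\ell_n^-,\ell_n^++\ell_n^-\in N_2$ and $n=\ell_n^+-\ell_n^-$. Let $\alpha,\beta$ be the maps on words over $\{0,1,2\}$ (finite or infinite) defined recursively by \[\alpha(0w)=0\alpha(w),\quad \alpha(1w)=1\alpha(w),\quad \alpha(2w)=1\beta(w),\] \[\beta(0w)=1\alpha(w),\quad \beta(1w)=1\beta(w),\quad \beta(2w)=0\beta(w).\] For an integer $m\ge0$ let $(m)_3=m_0m_1m_2\dots$ denote the infinite sequence of base-$3$ digits of $m$, least significant first ($m=\sum_j m_j3^j$, ending in infinitely many $0$'s). Then the sequence $(\ell_n)_{n\ge0}$ is a ternary transducer integer sequence generated by this transducer with initial state $\alpha$: for every $n\ge0$, $\alpha((n)_3)=(\ell_n)_3$.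
   Context: A transducer integer sequence generated by a transducer state $q$ is the sequence $(z_i)$ such that for each $i$ the output word $q((i)_{k_1})$ is the base-$k_2$ digit sequence (least significant first) of $z_i$; here both input and output are interpreted in base $3$. -}

module Defs where

open import Data.Nat using (ℕ; zero; suc; _^_; _/_)
open import Data.Nat.DivMod using (_mod_)
open import Data.Fin using (Fin; zero; suc)
open import Data.Product using (_×_; _,_; proj₁; proj₂)
open import Relation.Binary.PropositionalEquality using (_≢_)

Digit : Set
Digit = Fin 3

Word : Set
Word = ℕ → Digit

digits3 : ℕ → Word
digits3 m zero    = m mod 3
digits3 m (suc j) = digits3 (m / 3) j

N₂ : ℕ → Set
N₂ m = ∀ j → digits3 m j ≢ suc (suc zero)

data State : Set where
  α β : State

δ : State → Digit → State × Digit
δ α zero             = α , zero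
δ α (suc zero)       = α , suc zero
δ α (suc (suc zero)) = β , suc zero
δ β zero             = α , suc zero
δ β (suc zero)       = β , suc zero
δ β (suc (suc zero)) = β , zero

stateAt : State → Word → ℕ → State
stateAt q w zero    = q
stateAt q w (suc j) = proj₁ (δ (stateAt q w j) (w j))

run : State → Word → Word
run q w j = proj₂ (δ (stateAt q w j) (w j))

-- ℓ⁺ and ℓ⁻ collect the positive and the negative digits of the balanced
-- ternary expansion n = Σ εⱼ 3ʲ (εⱼ ∈ {-1, 0, 1}), so ℓₙ has the digits |εⱼ|.
-- Converting ordinary ternary digits dⱼ into balanced ones from the least
-- significant end needs a carry c ∈ {0, 1} with c + dⱼ = εⱼ + 3c′.  The states
-- α and β are the carries 0 and 1 and the output letter is |εⱼ|; the invariant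
-- of a run is ℓ⁺ − ℓ⁻ = c + (the number still to be read).
module Submission where

open import Defs
open import Data.Nat using (ℕ; zero; suc; _+_; _*_; _%_; _/_; _≤_; _<_; z≤n; s≤s; s≤s⁻¹; NonZero)
open import Data.Nat.Properties
open import Data.Nat.DivMod
open import Data.Nat.Divisibility using (n∣m*n)
open import Data.Nat.Induction using (<-rec)
open import Data.Nat.Tactic.RingSolver using (solve-∀)
open import Data.Fin using (toℕ)
open import Data.Fin.Patterns using (0F; 1F; 2F)
open import Data.Fin.Properties using (toℕ-injective; toℕ-fromℕ<)
open import Data.Product using (Σ; ∃₂; _×_; _,_; proj₁; proj₂)
open import Relation.Binary.PropositionalEquality
open ≡-Reasoning

toℕ-mod : ∀ m n .{{_ : NonZero n}} → toℕ (m mod n) ≡ m % n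
toℕ-mod m n = toℕ-fromℕ< (m%n<n m n)

[m+kn]/n≡m/n+k : ∀ m k n .{{_ : NonZero n}} → (m + k * n) / n ≡ m / n + k
[m+kn]/n≡m/n+k m k n = trans (+-distrib-/-∣ʳ m (n∣m*n k)) (cong (m / n +_) (m*n/n≡m k n))

+-*-interchange : ∀ b x P y M → x + P * b + (y + M * b) ≡ x + y + (P + M) * b
+-*-interchange = solve-∀

module _ {b : ℕ} .{{_ : NonZero b}} where

  [r+kb]%b≡r : ∀ {r} k → r < b → (r + k * b) % b ≡ r
  [r+kb]%b≡r {r} k r<b = trans ([m+kn]%n≡m%n r k b) (m<n⇒m%n≡m r<b)

  [r+kb]/b≡k : ∀ {r} k → r < b → (r + k * b) / b ≡ k
  [r+kb]/b≡k {r} k r<b = trans ([m+kn]/n≡m/n+k r k b) (cong (_+ k) (m<n⇒m/n≡0 r<b))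

  divMod-unique : ∀ s A {r k} → r < b → s + A * b ≡ r + k * b → s % b ≡ r × s / b + A ≡ k
  divMod-unique s A {r} {k} r<b e =
    (begin
      s % b             ≡⟨ [m+kn]%n≡m%n s A b ⟨
      (s + A * b) % b   ≡⟨ %-congˡ e ⟩
      (r + k * b) % b   ≡⟨ [r+kb]%b≡r k r<b ⟩
      r                 ∎) ,
    (begin
      s / b + A         ≡⟨ [m+kn]/n≡m/n+k s A b ⟨
      (s + A * b) / b   ≡⟨ /-congˡ e ⟩
      (r + k * b) / b   ≡⟨ [r+kb]/b≡k k r<b ⟩
      k                 ∎)

  -- The lowest column of the addition c + n + l = l′: s is its sum, s / b the carry out.
  +-column : ∀ c n l {l′} → c + n + l ≡ l′ →
             let s = c + n % b + l % b in
             s % b ≡ l′ % b × s / b + (n / b + l / b) ≡ l′ / b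
  +-column c n l {l′} e = divMod-unique (c + n % b + l % b) (n / b + l / b) (m%n<n l′ b) (begin
      c + n % b + l % b + (n / b + l / b) * b       ≡⟨ +-*-interchange b (c + n % b) (n / b) (l % b) (l / b) ⟨
      c + n % b + n / b * b + (l % b + l / b * b)   ≡⟨ cong (_+ (l % b + l / b * b)) (+-assoc c (n % b) (n / b * b)) ⟩
      c + (n % b + n / b * b) + (l % b + l / b * b) ≡⟨ cong₂ (λ n′ l″ → c + n′ + l″) (m≡m%n+[m/n]*n n b) (m≡m%n+[m/n]*n l b) ⟨
      c + n + l                                     ≡⟨ e ⟩
      l′                                            ≡⟨ m≡m%n+[m/n]*n l′ b ⟩
      l′ % b + l′ / b * b                           ∎)

N₂-zero : N₂ 0
N₂-zero zero    ()
N₂-zero (suc j) = N₂-zero j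

N₂-/3 : ∀ {m} → N₂ m → N₂ (m / 3)
N₂-/3 p j = p (suc j)

N₂⇒%3≤1 : ∀ {m} → N₂ m → m % 3 ≤ 1
N₂⇒%3≤1 {m} p = s≤s⁻¹ (≤∧≢⇒< (s≤s⁻¹ (m%n<n m 3)) m%3≢2)
  where
  m%3≢2 : m % 3 ≢ 2
  m%3≢2 m%3≡2 = p 0 (toℕ-injective (trans (toℕ-mod m 3) m%3≡2))

N₂-cons : ∀ {x P} → x ≤ 1 → N₂ P → N₂ (x + P * 3)
N₂-cons {x} {P} x≤1 p = λ
  { zero    digit≡2 → <⇒≢ (s≤s x≤1) (begin
      x                       ≡⟨ [r+kb]%b≡r P x<3 ⟨
      (x + P * 3) % 3         ≡⟨ toℕ-mod (x + P * 3) 3 ⟨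
      toℕ ((x + P * 3) mod 3) ≡⟨ cong toℕ digit≡2 ⟩
      2                       ∎)
  ; (suc j) → subst (λ m → digits3 m j ≢ 2F) (sym ([r+kb]/b≡k P x<3)) (p j)
  }
  where
  x<3 : x < 3
  x<3 = m≤n⇒m≤1+n (s≤s x≤1)

-- The digits x of ℓ⁺ and y of ℓ⁻ at a position whose balanced ternary digit is x − y.
data BalancedDigit : ℕ → ℕ → Set where
  ε0 : BalancedDigit 0 0
  ε+ : BalancedDigit 1 0
  ε- : BalancedDigit 0 1

balancedDigit : ∀ {x y} → x ≤ 1 → y ≤ 1 → (x + y) % 3 ≤ 1 → BalancedDigit x y
balancedDigit z≤n       z≤n       _           = ε0
balancedDigit (s≤s z≤n) z≤n       _           = ε+
balancedDigit z≤n       (s≤s z≤n) _           = ε-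
balancedDigit (s≤s z≤n) (s≤s z≤n) (s≤s ())

BalancedDigit⇒+≤1 : ∀ {x y} → BalancedDigit x y → x + y ≤ 1
BalancedDigit⇒+≤1 ε0 = z≤n
BalancedDigit⇒+≤1 ε+ = s≤s z≤n
BalancedDigit⇒+≤1 ε- = s≤s z≤n

Split : ℕ → ℕ → ℕ → Set
Split k ℓ⁺ ℓ⁻ = N₂ ℓ⁺ × N₂ ℓ⁻ × N₂ (ℓ⁺ + ℓ⁻) × k + ℓ⁻ ≡ ℓ⁺

Split-cons : ∀ {x y m k P M} → BalancedDigit x y → m + y ≡ x + k * 3 →
             Split k P M → Split m (x + P * 3) (y + M * 3)
Split-cons {x} {y} {m} {k} {P} {M} ε e (p , q , p+q , k+M≡P) =
  N₂-cons (≤-trans (m≤m+n x y) x+y≤1) p ,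
  N₂-cons (≤-trans (m≤n+m y x) x+y≤1) q ,
  subst N₂ (sym (+-*-interchange 3 x P y M)) (N₂-cons x+y≤1 p+q) ,
  (begin
    m + (y + M * 3)     ≡⟨ +-assoc m y (M * 3) ⟨
    m + y + M * 3       ≡⟨ cong (_+ M * 3) e ⟩
    x + k * 3 + M * 3   ≡⟨ +-assoc x (k * 3) (M * 3) ⟩
    x + (k * 3 + M * 3) ≡⟨ cong (x +_) (*-distribʳ-+ 3 k M) ⟨
    x + (k + M) * 3     ≡⟨ cong (λ t → x + t * 3) k+M≡P ⟩
    x + P * 3           ∎)
  where
  x+y≤1 : x + y ≤ 1
  x+y≤1 = BalancedDigit⇒+≤1 ε

split-exists : ∀ n → ∃₂ (Split n)
split-exists = <-rec (λ n → ∃₂ (Split n)) extend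
  where
  prepend : ∀ {x y m k} → BalancedDigit x y → m + y ≡ x + k * 3 → ∃₂ (Split k) → ∃₂ (Split m)
  prepend {x} {y} ε e (P , M , s) = x + P * 3 , y + M * 3 , Split-cons ε e s

  extend : ∀ n → (∀ {m} → m < n → ∃₂ (Split m)) → ∃₂ (Split n)
  extend n rec with n divMod 3
  ... | result zero    0F refl = 0 , 0 , N₂-zero , N₂-zero , N₂-zero , refl
  ... | result (suc q) 0F refl = prepend ε0 (+-identityʳ _) (rec (m<m*n (suc q) 3 (s≤s (s≤s z≤n))))
  ... | result q       1F refl = prepend ε+ (+-identityʳ _) (rec (s≤s (m≤m*n q 3)))
  ... | result q       2F refl = prepend ε- (+-comm (2 + q * 3) 1) (rec (s≤s (s≤s (m≤m*n q 3))))

carry : State → ℕ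
carry α = 0
carry β = 1

δ-balanced : ∀ q d {x y} → BalancedDigit x y → (carry q + toℕ d + y) % 3 ≡ x →
             toℕ (proj₂ (δ q d)) ≡ x + y × carry (proj₁ (δ q d)) ≡ (carry q + toℕ d + y) / 3
δ-balanced α 0F ε0 _  = refl , refl
δ-balanced α 0F ε+ ()
δ-balanced α 0F ε- ()
δ-balanced α 1F ε0 ()
δ-balanced α 1F ε+ _  = refl , refl
δ-balanced α 1F ε- ()
δ-balanced α 2F ε0 ()
δ-balanced α 2F ε+ ()
δ-balanced α 2F ε- _  = refl , refl
δ-balanced β 0F ε0 ()
δ-balanced β 0F ε+ _  = refl , refl
δ-balanced β 0F ε- ()
δ-balanced β 1F ε0 ()
δ-balanced β 1F ε+ ()
δ-balanced β 1F ε- _  = refl , refl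
δ-balanced β 2F ε0 _  = refl , refl
δ-balanced β 2F ε+ ()
δ-balanced β 2F ε- ()

stateAt-suc : ∀ q w j → stateAt q w (suc j) ≡ stateAt (proj₁ (δ q (w 0))) (λ i → w (suc i)) j
stateAt-suc q w zero    = refl
stateAt-suc q w (suc j) = cong (λ s → proj₁ (δ s (w (suc j)))) (stateAt-suc q w j)

run-suc : ∀ q w j → run q w (suc j) ≡ run (proj₁ (δ q (w 0))) (λ i → w (suc i)) j
run-suc q w j = cong (λ s → proj₂ (δ s (w (suc j)))) (stateAt-suc q w j)

module _ (q : State) {n ℓ⁺ ℓ⁻ : ℕ} (ℓ⁺∈N₂ : N₂ ℓ⁺) (ℓ⁻∈N₂ : N₂ ℓ⁻) (ℓ∈N₂ : N₂ (ℓ⁺ + ℓ⁻))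
         (difference : carry q + n + ℓ⁻ ≡ ℓ⁺) where
  private
    x y s : ℕ
    x = ℓ⁺ % 3
    y = ℓ⁻ % 3
    s = carry q + n % 3 + y

    ε : BalancedDigit x y
    ε = balancedDigit (N₂⇒%3≤1 ℓ⁺∈N₂) (N₂⇒%3≤1 ℓ⁻∈N₂)
          (subst (_≤ 1) (%-distribˡ-+ ℓ⁺ ℓ⁻ 3) (N₂⇒%3≤1 ℓ∈N₂))

    column : s % 3 ≡ x × s / 3 + (n / 3 + ℓ⁻ / 3) ≡ ℓ⁺ / 3
    column = +-column (carry q) n ℓ⁻ difference

    step : toℕ (proj₂ (δ q (n mod 3))) ≡ x + y
         × carry (proj₁ (δ q (n mod 3))) ≡ (carry q + toℕ (n mod 3) + y) / 3
    step = δ-balanced q (n mod 3) ε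
             (subst (λ r → (carry q + r + y) % 3 ≡ x) (sym (toℕ-mod n 3)) (proj₁ column))

    x+y<3 : x + y < 3
    x+y<3 = s≤s (m≤n⇒m≤1+n (BalancedDigit⇒+≤1 ε))

  δ-output : proj₂ (δ q (n mod 3)) ≡ (ℓ⁺ + ℓ⁻) mod 3
  δ-output = toℕ-injective (begin
    toℕ (proj₂ (δ q (n mod 3))) ≡⟨ proj₁ step ⟩
    x + y                       ≡⟨ m<n⇒m%n≡m x+y<3 ⟨
    (x + y) % 3                 ≡⟨ %-distribˡ-+ ℓ⁺ ℓ⁻ 3 ⟨
    (ℓ⁺ + ℓ⁻) % 3               ≡⟨ toℕ-mod (ℓ⁺ + ℓ⁻) 3 ⟨
    toℕ ((ℓ⁺ + ℓ⁻) mod 3)       ∎)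

  +-/3 : (ℓ⁺ + ℓ⁻) / 3 ≡ ℓ⁺ / 3 + ℓ⁻ / 3
  +-/3 = +-distrib-/ ℓ⁺ ℓ⁻ x+y<3

  Split-/3 : Split (carry (proj₁ (δ q (n mod 3))) + n / 3) (ℓ⁺ / 3) (ℓ⁻ / 3)
  Split-/3 = N₂-/3 ℓ⁺∈N₂ , N₂-/3 ℓ⁻∈N₂ , subst N₂ +-/3 (N₂-/3 ℓ∈N₂) , (begin
    carry (proj₁ (δ q (n mod 3))) + n / 3 + ℓ⁻ / 3   ≡⟨ +-assoc _ (n / 3) (ℓ⁻ / 3) ⟩
    carry (proj₁ (δ q (n mod 3))) + (n / 3 + ℓ⁻ / 3) ≡⟨ cong (_+ (n / 3 + ℓ⁻ / 3)) carry≡ ⟩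
    s / 3 + (n / 3 + ℓ⁻ / 3)                         ≡⟨ proj₂ column ⟩
    ℓ⁺ / 3                                           ∎)
    where
    carry≡ : carry (proj₁ (δ q (n mod 3))) ≡ s / 3
    carry≡ = trans (proj₂ step) (cong (λ r → (carry q + r + y) / 3) (toℕ-mod n 3))

run-correct : ∀ q n {ℓ⁺ ℓ⁻} → Split (carry q + n) ℓ⁺ ℓ⁻ →
              ∀ j → run q (digits3 n) j ≡ digits3 (ℓ⁺ + ℓ⁻) j
run-correct q n (ℓ⁺∈N₂ , ℓ⁻∈N₂ , ℓ∈N₂ , difference) zero =
  δ-output q ℓ⁺∈N₂ ℓ⁻∈N₂ ℓ∈N₂ difference
run-correct q n {ℓ⁺} {ℓ⁻} (ℓ⁺∈N₂ , ℓ⁻∈N₂ , ℓ∈N₂ , difference) (suc j) = begin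
  run q (digits3 n) (suc j)                       ≡⟨ run-suc q (digits3 n) j ⟩
  run (proj₁ (δ q (n mod 3))) (digits3 (n / 3)) j ≡⟨ run-correct _ (n / 3) (Split-/3 q ℓ⁺∈N₂ ℓ⁻∈N₂ ℓ∈N₂ difference) j ⟩
  digits3 (ℓ⁺ / 3 + ℓ⁻ / 3) j                     ≡⟨ cong (λ k → digits3 k j) (+-/3 q ℓ⁺∈N₂ ℓ⁻∈N₂ ℓ∈N₂ difference) ⟨
  digits3 ((ℓ⁺ + ℓ⁻) / 3) j                       ∎

mainTheorem4 : (n : ℕ) →
    Σ ℕ (λ lp → Σ ℕ (λ lm → N₂ lp × N₂ lm × N₂ (lp + lm) × n + lm ≡ lp))
    × ((lp lm : ℕ) → N₂ lp → N₂ lm → N₂ (lp + lm) → n + lm ≡ lp →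
         ∀ j → run α (digits3 n) j ≡ digits3 (lp + lm) j)
mainTheorem4 n = split-exists n , λ lp lm lp∈N₂ lm∈N₂ l∈N₂ difference →
  run-correct α n (lp∈N₂ , lm∈N₂ , l∈N₂ , difference)
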